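{- Let $p$ be a prime and let $P(x)\in\mathbb F_p[x]$ factor in $\mathbb F_p[x]$ as $P(x)=R(x)S(x)$ with $R(x)$ completely reducible. Then $P(x)$ divides $P'(x)\cdot\overline P(x)\cdot S(x)$, where $P'$ is the derivative of $P$ and $\overline P$ is the polynomial of degree $<p$ such that $P(x)\equiv\overline P(x)\pmod{x^p-x}$.
   Context: A polynomial in $\mathbb F_p[x]$ is completely reducible if it factors in $\mathbb F_p[x]$ as a product of polynomials of degree one (up to a nonzero constant). -}

module Defs where

open import Data.Nat as ℕ using (ℕ; zero; suc)
open import Data.Integer as ℤ using (ℤ; +_; -_; _-_)
open import Data.Integer.Divisibility using (_∣_)
open import Data.List using (List; []; _∷_; replicate; _++_; [_]; foldr; length)
open import Data.Product using (Σ; ∃; _×_; _,_)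
open import Relation.Nullary using (¬_)

-- Polynomials with integer coefficients, little-endian: a₀ ∷ a₁ ∷ … represents a₀ + a₁x + …
-- F_p[x] is modelled as ℤ[x] modulo the setoid relation "all coefficients congruent mod p"
-- (i.e. ℤ[x]/pℤ[x] ≅ F_p[x]).
Poly : Set
Poly = List ℤ

coeff : Poly → ℕ → ℤ
coeff []       _       = + 0
coeff (a ∷ _)  zero    = a
coeff (_ ∷ as) (suc n) = coeff as n

infixl 6 _+ₚ_ _-ₚ_
infixl 7 _*ₚ_ _·ₚ_

_+ₚ_ : Poly → Poly → Poly
[]       +ₚ q        = q
(a ∷ as) +ₚ []       = a ∷ as
(a ∷ as) +ₚ (b ∷ bs) = (a ℤ.+ b) ∷ (as +ₚ bs)

_·ₚ_ : ℤ → Poly → Poly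
c ·ₚ []       = []
c ·ₚ (a ∷ as) = (c ℤ.* a) ∷ (c ·ₚ as)

negₚ : Poly → Poly
negₚ q = (- + 1) ·ₚ q

_-ₚ_ : Poly → Poly → Poly
q -ₚ r = q +ₚ negₚ r

_*ₚ_ : Poly → Poly → Poly
[]       *ₚ q = []
(a ∷ as) *ₚ q = (a ·ₚ q) +ₚ (+ 0 ∷ (as *ₚ q))

const : ℤ → Poly
const c = [ c ]

xpow : ℕ → Poly
xpow n = replicate n (+ 0) ++ [ + 1 ]

derivFrom : ℕ → Poly → Poly
derivFrom n []       = []
derivFrom n (a ∷ as) = (+ n ℤ.* a) ∷ derivFrom (suc n) as

deriv : Poly → Poly
deriv []       = []
deriv (_ ∷ as) = derivFrom 1 as

_≈[_]_ : Poly → ℕ → Poly → Set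
q ≈[ p ] r = ∀ n → (+ p) ∣ (coeff q n - coeff r n)

_∣[_]_ : Poly → ℕ → Poly → Set
a ∣[ p ] b = ∃ λ q → b ≈[ p ] (a *ₚ q)

NonZeroMod : ℕ → ℤ → Set
NonZeroMod p c = ¬ ((+ p) ∣ c)

linear : ℤ × ℤ → Poly
linear (b , a) = b ∷ a ∷ []

productₚ : List Poly → Poly
productₚ = foldr _*ₚ_ (const (+ 1))

data AllDegOne (p : ℕ) : List (ℤ × ℤ) → Set where
  []  : AllDegOne p []
  _∷_ : ∀ {b a ls} → NonZeroMod p a → AllDegOne p ls → AllDegOne p ((b , a) ∷ ls)

linears : List (ℤ × ℤ) → List Poly
linears []       = []
linears (l ∷ ls) = linear l ∷ linears ls

CompletelyReducible : ℕ → Poly → Set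
CompletelyReducible p r =
  Σ ℤ λ c → Σ (List (ℤ × ℤ)) λ ls →
    NonZeroMod p c × AllDegOne p ls × (r ≈[ p ] (const c *ₚ productₚ (linears ls)))

-- Write R = c·∏ Lᵢ with Lᵢ = bᵢ + aᵢx, aᵢ ≠ 0. Each Lᵢ is a unit multiple of some x − r,
-- and x − r divides (xᵖ − rᵖ) − (x − r), which is xᵖ − x by Fermat's little theorem
-- (proved via (x + y)ᵖ ≡ xᵖ + yᵖ, as p divides the inner binomial coefficients).
-- If every factor of a product Π divides F, the Leibniz rule and induction give
-- Π ∣ (Π·S)′·F. So P = c·Π·S divides P′·(xᵖ − x)·S, and since P̄ ≡ P modulo xᵖ − x,
-- P′·P̄·S ≡ P′·P·S modulo P′·(xᵖ − x)·S.
module Submission where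

open import Defs
open import Data.Nat as ℕ using (ℕ; zero; suc; _≤_; _<_)
import Data.Nat.Properties as ℕ
import Data.Nat.Divisibility as ℕ
open import Data.Nat.Combinatorics using (_C_; nC1≡n; nCn≡1; nCk+nC[k+1]≡[n+1]C[k+1])
open import Data.Nat.Primality using (Prime; euclidsLemma)
import Data.Nat.Tactic.RingSolver as ℕ-Solver
open import Data.Integer as ℤ using (ℤ; +_; -[1+_])
import Data.Integer.Properties as ℤ
import Data.Integer.Divisibility.Signed as ℤ
open import Data.Integer.Tactic.RingSolver using (solve-∀)
open import Data.Fin as Fin using (toℕ; inject₁)
import Data.Fin.Properties as Fin
open import Data.Vec.Functional using (Vector; init; last; tail)
open import Data.List using ([]; _∷_; length)
open import Data.List.Relation.Unary.All using (All; []; _∷_)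
open import Data.Product using (_×_; _,_; proj₁; proj₂)
open import Data.Sum using (_⊎_; inj₁; inj₂; [_,_]′)
open import Data.Maybe using (Maybe; just; nothing)
open import Data.Empty using (⊥-elim)
open import Function using (_∘_)
open import Level using (0ℓ)
open import Relation.Nullary using (¬_; yes)
open import Relation.Binary.Bundles using (Setoid)
open import Relation.Binary.PropositionalEquality
  using (_≡_; refl; sym; trans; cong; cong₂; subst; subst₂; isEquivalence; module ≡-Reasoning)
open import Algebra.Bundles using (CommutativeRing; CommutativeSemigroup)
open import Algebra.Structures using (IsCommutativeRing)
open import Algebra.Consequences.Setoid using (comm∧invʳ⇒inv; comm∧idˡ⇒id; comm∧distrʳ⇒distr)
import Algebra.Properties.CommutativeSemigroup
import Algebra.Properties.CommutativeSemigroup.Divisibility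
import Algebra.Properties.Monoid.Divisibility
open import Algebra.Properties.CommutativeSemiring.Binomial ℤ.+-*-commutativeSemiring
  using (binomialTerm) renaming (theorem to binomial-theorem)
open import Algebra.Properties.Monoid.Sum ℤ.+-0-monoid using (sum; sum-init-last)
import Algebra.Definitions.RawMonoid ℤ.+-0-rawMonoid as ℤ-Mult
import Algebra.Definitions.RawSemiring ℤ.+-*-rawSemiring as ℤ-Exp
open import Tactic.RingSolver.Core.AlmostCommutativeRing using (AlmostCommutativeRing; fromCommutativeRing)
import Tactic.RingSolver as Ring-Solver

coeff-+ₚ : ∀ f g n → coeff (f +ₚ g) n ≡ coeff f n ℤ.+ coeff g n
coeff-+ₚ []      g       n       = sym (ℤ.+-identityˡ _)
coeff-+ₚ (a ∷ f) []      n       = sym (ℤ.+-identityʳ _)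
coeff-+ₚ (a ∷ f) (b ∷ g) zero    = refl
coeff-+ₚ (a ∷ f) (b ∷ g) (suc n) = coeff-+ₚ f g n

coeff-·ₚ : ∀ c f n → coeff (c ·ₚ f) n ≡ c ℤ.* coeff f n
coeff-·ₚ c []      n       = sym (ℤ.*-zeroʳ c)
coeff-·ₚ c (a ∷ f) zero    = refl
coeff-·ₚ c (a ∷ f) (suc n) = coeff-·ₚ c f n

+ₚ-identityʳ : ∀ f → f +ₚ [] ≡ f
+ₚ-identityʳ []      = refl
+ₚ-identityʳ (a ∷ f) = refl

+ₚ-comm : ∀ f g → f +ₚ g ≡ g +ₚ f
+ₚ-comm []      g       = sym (+ₚ-identityʳ g)
+ₚ-comm (a ∷ f) []      = refl
+ₚ-comm (a ∷ f) (b ∷ g) = cong₂ _∷_ (ℤ.+-comm a b) (+ₚ-comm f g)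

+ₚ-assoc : ∀ f g h → (f +ₚ g) +ₚ h ≡ f +ₚ (g +ₚ h)
+ₚ-assoc []      g       h       = refl
+ₚ-assoc (a ∷ f) []      h       = refl
+ₚ-assoc (a ∷ f) (b ∷ g) []      = refl
+ₚ-assoc (a ∷ f) (b ∷ g) (c ∷ h) = cong₂ _∷_ (ℤ.+-assoc a b c) (+ₚ-assoc f g h)

+ₚ-commutativeSemigroup : CommutativeSemigroup 0ℓ 0ℓ
+ₚ-commutativeSemigroup = record
  { _∙_ = _+ₚ_
  ; isCommutativeSemigroup = record
    { isSemigroup = record
      { isMagma = record { isEquivalence = isEquivalence ; ∙-cong = cong₂ _+ₚ_ }
      ; assoc   = +ₚ-assoc
      }
    ; comm = +ₚ-comm
    }
  }

open Algebra.Properties.CommutativeSemigroup +ₚ-commutativeSemigroup using (x∙yz≈y∙xz; interchange)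

·ₚ-identityˡ : ∀ f → + 1 ·ₚ f ≡ f
·ₚ-identityˡ []      = refl
·ₚ-identityˡ (a ∷ f) = cong₂ _∷_ (ℤ.*-identityˡ a) (·ₚ-identityˡ f)

·ₚ-distribˡ : ∀ c f g → c ·ₚ (f +ₚ g) ≡ c ·ₚ f +ₚ c ·ₚ g
·ₚ-distribˡ c []      g       = refl
·ₚ-distribˡ c (a ∷ f) []      = refl
·ₚ-distribˡ c (a ∷ f) (b ∷ g) = cong₂ _∷_ (ℤ.*-distribˡ-+ c a b) (·ₚ-distribˡ c f g)

·ₚ-distribʳ : ∀ a b f → (a ℤ.+ b) ·ₚ f ≡ a ·ₚ f +ₚ b ·ₚ f
·ₚ-distribʳ a b []      = refl
·ₚ-distribʳ a b (c ∷ f) = cong₂ _∷_ (ℤ.*-distribʳ-+ c a b) (·ₚ-distribʳ a b f)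

·ₚ-assoc : ∀ a b f → a ·ₚ (b ·ₚ f) ≡ (a ℤ.* b) ·ₚ f
·ₚ-assoc a b []      = refl
·ₚ-assoc a b (c ∷ f) = cong₂ _∷_ (sym (ℤ.*-assoc a b c)) (·ₚ-assoc a b f)

derivFrom-+ₚ : ∀ m f g → derivFrom m (f +ₚ g) ≡ derivFrom m f +ₚ derivFrom m g
derivFrom-+ₚ m []      g       = refl
derivFrom-+ₚ m (a ∷ f) []      = refl
derivFrom-+ₚ m (a ∷ f) (b ∷ g) = cong₂ _∷_ (ℤ.*-distribˡ-+ (+ m) a b) (derivFrom-+ₚ (suc m) f g)

deriv-+ₚ : ∀ f g → deriv (f +ₚ g) ≡ deriv f +ₚ deriv g
deriv-+ₚ []      g       = refl
deriv-+ₚ (a ∷ f) []      = sym (+ₚ-identityʳ _)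
deriv-+ₚ (a ∷ f) (b ∷ g) = derivFrom-+ₚ 1 f g

derivFrom-·ₚ : ∀ m c f → derivFrom m (c ·ₚ f) ≡ c ·ₚ derivFrom m f
derivFrom-·ₚ m c []      = refl
derivFrom-·ₚ m c (a ∷ f) = cong₂ _∷_ (x∙yz≡y∙xz (+ m) c a) (derivFrom-·ₚ (suc m) c f)
  where x∙yz≡y∙xz : ∀ x y z → x ℤ.* (y ℤ.* z) ≡ y ℤ.* (x ℤ.* z)
        x∙yz≡y∙xz = solve-∀

deriv-·ₚ : ∀ c f → deriv (c ·ₚ f) ≡ c ·ₚ deriv f
deriv-·ₚ c []      = refl
deriv-·ₚ c (a ∷ f) = derivFrom-·ₚ 1 c f

coeff-derivFrom : ∀ m f n → coeff (derivFrom m f) n ≡ + (m ℕ.+ n) ℤ.* coeff f n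
coeff-derivFrom m []      n       = sym (ℤ.*-zeroʳ (+ (m ℕ.+ n)))
coeff-derivFrom m (a ∷ f) zero    = cong (λ k → + k ℤ.* a) (sym (ℕ.+-identityʳ m))
coeff-derivFrom m (a ∷ f) (suc n) =
  trans (coeff-derivFrom (suc m) f n) (cong (λ k → + k ℤ.* coeff f n) (sym (ℕ.+-suc m n)))

coeff-deriv : ∀ f n → coeff (deriv f) n ≡ + suc n ℤ.* coeff f (suc n)
coeff-deriv []      n = sym (ℤ.*-zeroʳ (+ suc n))
coeff-deriv (a ∷ f) n = coeff-derivFrom 1 f n

-- Binomial coefficients and primes

[k+1]*[n+1]C[k+1]≡[n+1]*nCk : ∀ n k → suc k ℕ.* (suc n C suc k) ≡ suc n ℕ.* (n C k)
[k+1]*[n+1]C[k+1]≡[n+1]*nCk zero    zero    = refl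
[k+1]*[n+1]C[k+1]≡[n+1]*nCk zero    (suc k) = ℕ.*-zeroʳ (suc (suc k))
[k+1]*[n+1]C[k+1]≡[n+1]*nCk (suc n) zero    =
  trans (ℕ.*-identityˡ _) (trans (nC1≡n (suc (suc n))) (sym (ℕ.*-identityʳ (suc (suc n)))))
[k+1]*[n+1]C[k+1]≡[n+1]*nCk (suc n) (suc k) = begin
  suc (suc k) ℕ.* (suc (suc n) C suc (suc k))
    ≡⟨ cong (suc (suc k) ℕ.*_) (nCk+nC[k+1]≡[n+1]C[k+1] (suc n) (suc k)) ⟨
  suc (suc k) ℕ.* (A ℕ.+ D)
    ≡⟨ expand k A D ⟩
  A ℕ.+ (suc k ℕ.* A ℕ.+ suc (suc k) ℕ.* D)
    ≡⟨ cong (A ℕ.+_) (cong₂ ℕ._+_ ([k+1]*[n+1]C[k+1]≡[n+1]*nCk n k) ([k+1]*[n+1]C[k+1]≡[n+1]*nCk n (suc k))) ⟩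
  A ℕ.+ (suc n ℕ.* (n C k) ℕ.+ suc n ℕ.* (n C suc k))
    ≡⟨ cong (A ℕ.+_) (ℕ.*-distribˡ-+ (suc n) (n C k) (n C suc k)) ⟨
  A ℕ.+ suc n ℕ.* (n C k ℕ.+ n C suc k)
    ≡⟨ cong (λ c → A ℕ.+ suc n ℕ.* c) (nCk+nC[k+1]≡[n+1]C[k+1] n k) ⟩
  suc (suc n) ℕ.* A ∎
  where
  open ≡-Reasoning
  A = suc n C suc k
  D = suc n C suc (suc k)
  expand : ∀ k A D → suc (suc k) ℕ.* (A ℕ.+ D) ≡ A ℕ.+ (suc k ℕ.* A ℕ.+ suc (suc k) ℕ.* D)
  expand = ℕ-Solver.solve-∀

prime∣pCk : ∀ {p k} → Prime p → 0 < k → k < p → p ℕ.∣ p C k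
prime∣pCk {suc n} {suc k} p-prime _ k<p
  with euclidsLemma (suc k) (suc n C suc k) p-prime
         (ℕ.divides (n C k) (trans ([k+1]*[n+1]C[k+1]≡[n+1]*nCk n k) (ℕ.*-comm (suc n) (n C k))))
... | inj₁ p∣k+1 = ⊥-elim (ℕ.<⇒≱ k<p (ℕ.∣⇒≤ p∣k+1))
... | inj₂ p∣C   = p∣C

euclidsLemma-ℤ : ∀ {p} x y → Prime p → + p ℤ.∣ x ℤ.* y → + p ℤ.∣ x ⊎ + p ℤ.∣ y
euclidsLemma-ℤ x y p-prime p∣xy
  with euclidsLemma ℤ.∣ x ∣ ℤ.∣ y ∣ p-prime (subst (_ ℕ.∣_) (ℤ.abs-* x y) (ℤ.∣⇒∣ᵤ p∣xy))
... | inj₁ p∣x = inj₁ (ℤ.∣ᵤ⇒∣ p∣x)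
... | inj₂ p∣y = inj₂ (ℤ.∣ᵤ⇒∣ p∣y)

×≡* : ∀ n x → n ℤ-Mult.× x ≡ + n ℤ.* x
×≡* zero    x = sym (ℤ.*-zeroˡ x)
×≡* (suc n) x = trans (cong (ℤ._+_ x) (×≡* n x)) (sym (ℤ.suc-* (+ n) x))

^≡^ : ∀ x n → x ℤ-Exp.^ n ≡ x ℤ.^ n
^≡^ x zero    = refl
^≡^ x (suc n) = cong (x ℤ.*_) (^≡^ x n)

∣-sum : ∀ {d n} (t : Vector ℤ n) → (∀ i → d ℤ.∣ t i) → d ℤ.∣ sum t
∣-sum {n = zero}  t d∣t = ℤ.divides (+ 0) refl
∣-sum {n = suc n} t d∣t = ℤ.∣m∣n⇒∣m+n (d∣t Fin.zero) (∣-sum (tail t) (d∣t ∘ Fin.suc))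

module Divisibility (R : CommutativeRing 0ℓ 0ℓ) where

  open CommutativeRing R
    using (_≈_; _+_; _*_; _-_; -_; distribʳ; +-cong; -‿cong; ring; *-commutativeSemigroup; *-monoid)
    renaming (trans to ≈-trans; sym to ≈-sym)
  open Algebra.Properties.CommutativeSemigroup.Divisibility *-commutativeSemigroup public
  open Algebra.Properties.Monoid.Divisibility *-monoid public using (ε∣_; ∣ʳ-refl)

  ∣-+ : ∀ {x y z} → x ∣ y → x ∣ z → x ∣ y + z
  ∣-+ {x} (q , qx≈y) (r , rx≈z) = q + r , ≈-trans (distribʳ x q r) (+-cong qx≈y rx≈z)

  ∣-‿ : ∀ {x y} → x ∣ y → x ∣ - y
  ∣-‿ {x} (q , qx≈y) = - q , ≈-trans (≈-sym (-‿distribˡ-* q x)) (-‿cong qx≈y)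
    where open import Algebra.Properties.Ring ring using (-‿distribˡ-*)

  ∣-- : ∀ {x y z} → x ∣ y → x ∣ z → x ∣ y - z
  ∣-- x∣y x∣z = ∣-+ x∣y (∣-‿ x∣z)

-- ℤ and ℤ[x] modulo p

module Modulo (p : ℕ) where

  infix 4 _≡ₘ_ _≈_

  record _≡ₘ_ (x y : ℤ) : Set where
    constructor mod
    field divides-diff : + p ℤ.∣ x ℤ.- y
  open _≡ₘ_ public

  private
    p∣-subst : ∀ {x y} → x ≡ y → + p ℤ.∣ x → + p ℤ.∣ y
    p∣-subst = subst (+ p ℤ.∣_)

  ∣⇒≡ₘ0 : ∀ {x} → + p ℤ.∣ x → x ≡ₘ + 0
  ∣⇒≡ₘ0 {x} p∣x = mod (p∣-subst (sym (ℤ.+-identityʳ x)) p∣x)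

  ≡⇒≡ₘ : ∀ {x y} → x ≡ y → x ≡ₘ y
  ≡⇒≡ₘ {x} refl = mod (p∣-subst (sym (ℤ.+-inverseʳ x)) (ℤ.divides (+ 0) refl))

  ≡ₘ-refl : ∀ {x} → x ≡ₘ x
  ≡ₘ-refl = ≡⇒≡ₘ refl

  ≡ₘ-sym : ∀ {x y} → x ≡ₘ y → y ≡ₘ x
  ≡ₘ-sym {x} {y} (mod p∣x-y) = mod (p∣-subst (-[x-y]≡y-x x y) (ℤ.∣m⇒∣-m p∣x-y))
    where -[x-y]≡y-x : ∀ x y → ℤ.- (x ℤ.- y) ≡ y ℤ.- x
          -[x-y]≡y-x = solve-∀

  ≡ₘ-trans : ∀ {x y z} → x ≡ₘ y → y ≡ₘ z → x ≡ₘ z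
  ≡ₘ-trans {x} {y} {z} (mod p∣x-y) (mod p∣y-z) =
    mod (p∣-subst (telescope x y z) (ℤ.∣m∣n⇒∣m+n p∣x-y p∣y-z))
    where telescope : ∀ x y z → (x ℤ.- y) ℤ.+ (y ℤ.- z) ≡ x ℤ.- z
          telescope = solve-∀

  ≡ₘ-setoid : Setoid 0ℓ 0ℓ
  ≡ₘ-setoid = record
    { Carrier = ℤ ; _≈_ = _≡ₘ_
    ; isEquivalence = record { refl = ≡ₘ-refl ; sym = ≡ₘ-sym ; trans = ≡ₘ-trans } }

  +-congₘ : ∀ {x x′ y y′} → x ≡ₘ x′ → y ≡ₘ y′ → x ℤ.+ y ≡ₘ x′ ℤ.+ y′
  +-congₘ {x} {x′} {y} {y′} (mod p∣x-x′) (mod p∣y-y′) =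
    mod (p∣-subst (interchange-ℤ x x′ y y′) (ℤ.∣m∣n⇒∣m+n p∣x-x′ p∣y-y′))
    where interchange-ℤ : ∀ x x′ y y′ → (x ℤ.- x′) ℤ.+ (y ℤ.- y′) ≡ (x ℤ.+ y) ℤ.- (x′ ℤ.+ y′)
          interchange-ℤ = solve-∀

  *-congˡₘ : ∀ c {x y} → x ≡ₘ y → c ℤ.* x ≡ₘ c ℤ.* y
  *-congˡₘ c {x} {y} (mod p∣x-y) = mod (p∣-subst (distribˡ-- c x y) (ℤ.∣n⇒∣m*n c p∣x-y))
    where distribˡ-- : ∀ c x y → c ℤ.* (x ℤ.- y) ≡ c ℤ.* x ℤ.- c ℤ.* y
          distribˡ-- = solve-∀

  *-congʳₘ : ∀ c {x y} → x ≡ₘ y → x ℤ.* c ≡ₘ y ℤ.* c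
  *-congʳₘ c {x} {y} e = subst₂ _≡ₘ_ (ℤ.*-comm c x) (ℤ.*-comm c y) (*-congˡₘ c e)

  -- The relation _≈[ p ]_, as a record over signed divisibility so that f and g can be
  -- inferred from a proof.
  record _≈_ (f g : Poly) : Set where
    constructor coeffwise
    field coeff-≡ₘ : ∀ n → coeff f n ≡ₘ coeff g n
  open _≈_ public

  coeffwise-≡ : ∀ {f g} → (∀ n → coeff f n ≡ coeff g n) → f ≈ g
  coeffwise-≡ e = coeffwise λ n → ≡⇒≡ₘ (e n)

  ≈-refl : ∀ {f} → f ≈ f
  ≈-refl = coeffwise-≡ λ _ → refl

  ≈-sym : ∀ {f g} → f ≈ g → g ≈ f
  ≈-sym e = coeffwise λ n → ≡ₘ-sym (coeff-≡ₘ e n)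

  ≈-trans : ∀ {f g h} → f ≈ g → g ≈ h → f ≈ h
  ≈-trans e e′ = coeffwise λ n → ≡ₘ-trans (coeff-≡ₘ e n) (coeff-≡ₘ e′ n)

  setoid : Setoid 0ℓ 0ℓ
  setoid = record
    { Carrier = Poly ; _≈_ = _≈_
    ; isEquivalence = record { refl = ≈-refl ; sym = ≈-sym ; trans = ≈-trans } }

  open import Relation.Binary.Reasoning.Setoid setoid

  ≡⇒≈ : ∀ {f g} → f ≡ g → f ≈ g
  ≡⇒≈ refl = ≈-refl

  ∷-cong : ∀ {a b f g} → a ≡ₘ b → f ≈ g → a ∷ f ≈ b ∷ g
  ∷-cong a≡b f≈g = coeffwise λ { zero → a≡b ; (suc n) → coeff-≡ₘ f≈g n }

  +ₚ-cong : ∀ {f f′ g g′} → f ≈ f′ → g ≈ g′ → f +ₚ g ≈ f′ +ₚ g′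
  +ₚ-cong {f} {f′} {g} {g′} e e′ = coeffwise λ n →
    subst₂ _≡ₘ_ (sym (coeff-+ₚ f g n)) (sym (coeff-+ₚ f′ g′ n)) (+-congₘ (coeff-≡ₘ e n) (coeff-≡ₘ e′ n))

  ·ₚ-congʳ : ∀ c {f g} → f ≈ g → c ·ₚ f ≈ c ·ₚ g
  ·ₚ-congʳ c {f} {g} e = coeffwise λ n →
    subst₂ _≡ₘ_ (sym (coeff-·ₚ c f n)) (sym (coeff-·ₚ c g n)) (*-congˡₘ c (coeff-≡ₘ e n))

  ·ₚ-congˡ : ∀ {a b} f → a ≡ₘ b → a ·ₚ f ≈ b ·ₚ f
  ·ₚ-congˡ {a} {b} f e = coeffwise λ n →
    subst₂ _≡ₘ_ (sym (coeff-·ₚ a f n)) (sym (coeff-·ₚ b f n)) (*-congʳₘ (coeff f n) e)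

  ·ₚ-zeroˡ : ∀ f → + 0 ·ₚ f ≈ []
  ·ₚ-zeroˡ f = coeffwise-≡ λ n → trans (coeff-·ₚ (+ 0) f n) (ℤ.*-zeroˡ (coeff f n))

  -ₚ-inverseʳ : ∀ f → f -ₚ f ≈ []
  -ₚ-inverseʳ f = coeffwise-≡ λ n →
    trans (coeff-+ₚ f (negₚ f) n)
          (trans (cong (λ y → coeff f n ℤ.+ y) (coeff-·ₚ (ℤ.- + 1) f n)) (identity (coeff f n)))
    where identity : ∀ x → x ℤ.+ (ℤ.- + 1) ℤ.* x ≡ + 0
          identity = solve-∀

  ∷-injective : ∀ {a b f g} → a ∷ f ≈ b ∷ g → a ≡ₘ b × f ≈ g
  ∷-injective e = coeff-≡ₘ e 0 , coeffwise λ n → coeff-≡ₘ e (suc n)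

  ∷≈[] : ∀ {a f} → a ∷ f ≈ [] → a ≡ₘ + 0 × f ≈ []
  ∷≈[] e = coeff-≡ₘ e 0 , coeffwise λ n → coeff-≡ₘ e (suc n)

  ≈[]⇒∷≈[] : ∀ {a f} → a ≡ₘ + 0 → f ≈ [] → a ∷ f ≈ []
  ≈[]⇒∷≈[] a≡0 f≈[] = coeffwise λ { zero → a≡0 ; (suc n) → coeff-≡ₘ f≈[] n }

  0∷[]≈[] : + 0 ∷ [] ≈ []
  0∷[]≈[] = ≈[]⇒∷≈[] ≡ₘ-refl ≈-refl

  *ₚ-zeroʳ : ∀ f → f *ₚ [] ≈ []
  *ₚ-zeroʳ []      = ≈-refl
  *ₚ-zeroʳ (a ∷ f) = ≈[]⇒∷≈[] ≡ₘ-refl (*ₚ-zeroʳ f)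

  const*ₚ : ∀ c f → const c *ₚ f ≈ c ·ₚ f
  const*ₚ c f = ≈-trans (+ₚ-cong ≈-refl 0∷[]≈[]) (≡⇒≈ (+ₚ-identityʳ _))

  *ₚ-identityˡ : ∀ f → const (+ 1) *ₚ f ≈ f
  *ₚ-identityˡ f = ≈-trans (const*ₚ (+ 1) f) (≡⇒≈ (·ₚ-identityˡ f))

  *ₚ-∷ʳ : ∀ g a f → g *ₚ (a ∷ f) ≈ a ·ₚ g +ₚ (+ 0 ∷ g *ₚ f)
  *ₚ-∷ʳ []      a f = ≈-sym 0∷[]≈[]
  *ₚ-∷ʳ (b ∷ g) a f = ∷-cong (≡⇒≡ₘ (cong (ℤ._+ + 0) (ℤ.*-comm b a))) (begin
    b ·ₚ f +ₚ g *ₚ (a ∷ f)                  ≈⟨ +ₚ-cong ≈-refl (*ₚ-∷ʳ g a f) ⟩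
    b ·ₚ f +ₚ (a ·ₚ g +ₚ (+ 0 ∷ g *ₚ f))    ≡⟨ x∙yz≈y∙xz (b ·ₚ f) (a ·ₚ g) _ ⟩
    a ·ₚ g +ₚ (b ·ₚ f +ₚ (+ 0 ∷ g *ₚ f))    ∎)

  *ₚ-comm : ∀ f g → f *ₚ g ≈ g *ₚ f
  *ₚ-comm []      g = ≈-sym (*ₚ-zeroʳ g)
  *ₚ-comm (a ∷ f) g = ≈-trans (+ₚ-cong ≈-refl (∷-cong ≡ₘ-refl (*ₚ-comm f g))) (≈-sym (*ₚ-∷ʳ g a f))

  *ₚ-distribʳ : ∀ h f g → (f +ₚ g) *ₚ h ≈ f *ₚ h +ₚ g *ₚ h
  *ₚ-distribʳ h []      g       = ≈-refl
  *ₚ-distribʳ h (a ∷ f) []      = ≡⇒≈ (sym (+ₚ-identityʳ _))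
  *ₚ-distribʳ h (a ∷ f) (b ∷ g) = begin
    (a ℤ.+ b) ·ₚ h +ₚ (+ 0 ∷ (f +ₚ g) *ₚ h)
      ≈⟨ +ₚ-cong (≡⇒≈ (·ₚ-distribʳ a b h)) (∷-cong ≡ₘ-refl (*ₚ-distribʳ h f g)) ⟩
    (a ·ₚ h +ₚ b ·ₚ h) +ₚ ((+ 0 ∷ f *ₚ h) +ₚ (+ 0 ∷ g *ₚ h))
      ≡⟨ interchange (a ·ₚ h) (b ·ₚ h) _ _ ⟩
    (a ·ₚ h +ₚ (+ 0 ∷ f *ₚ h)) +ₚ (b ·ₚ h +ₚ (+ 0 ∷ g *ₚ h)) ∎

  ·ₚ-*ₚ-assoc : ∀ c f g → (c ·ₚ f) *ₚ g ≈ c ·ₚ (f *ₚ g)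
  ·ₚ-*ₚ-assoc c []      g = ≈-refl
  ·ₚ-*ₚ-assoc c (a ∷ f) g = begin
    (c ℤ.* a) ·ₚ g +ₚ (+ 0 ∷ (c ·ₚ f) *ₚ g)
      ≈⟨ +ₚ-cong (≡⇒≈ (sym (·ₚ-assoc c a g)))
                 (∷-cong (≡⇒≡ₘ (sym (ℤ.*-zeroʳ c))) (·ₚ-*ₚ-assoc c f g)) ⟩
    c ·ₚ (a ·ₚ g) +ₚ c ·ₚ (+ 0 ∷ f *ₚ g)
      ≡⟨ ·ₚ-distribˡ c (a ·ₚ g) _ ⟨
    c ·ₚ (a ·ₚ g +ₚ (+ 0 ∷ f *ₚ g)) ∎

  *ₚ-assoc : ∀ f g h → (f *ₚ g) *ₚ h ≈ f *ₚ (g *ₚ h)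
  *ₚ-assoc []      g h = ≈-refl
  *ₚ-assoc (a ∷ f) g h = begin
    (a ·ₚ g +ₚ (+ 0 ∷ f *ₚ g)) *ₚ h          ≈⟨ *ₚ-distribʳ h (a ·ₚ g) _ ⟩
    (a ·ₚ g) *ₚ h +ₚ (+ 0 ·ₚ h +ₚ (+ 0 ∷ (f *ₚ g) *ₚ h))
      ≈⟨ +ₚ-cong (·ₚ-*ₚ-assoc a g h) (+ₚ-cong (·ₚ-zeroˡ h) (∷-cong ≡ₘ-refl (*ₚ-assoc f g h))) ⟩
    a ·ₚ (g *ₚ h) +ₚ (+ 0 ∷ f *ₚ (g *ₚ h))   ∎

  ≈[]⇒*ₚ≈[] : ∀ {f} g → f ≈ [] → f *ₚ g ≈ []
  ≈[]⇒*ₚ≈[] {[]}    g e = ≈-refl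
  ≈[]⇒*ₚ≈[] {a ∷ f} g e = begin
    a ·ₚ g +ₚ (+ 0 ∷ f *ₚ g)
      ≈⟨ +ₚ-cong (·ₚ-congˡ g (proj₁ (∷≈[] e))) (∷-cong ≡ₘ-refl (≈[]⇒*ₚ≈[] g (proj₂ (∷≈[] e)))) ⟩
    + 0 ·ₚ g +ₚ (+ 0 ∷ [])
      ≈⟨ +ₚ-cong (·ₚ-zeroˡ g) 0∷[]≈[] ⟩
    []                        ∎

  *ₚ-congˡ : ∀ {f f′} g → f ≈ f′ → f *ₚ g ≈ f′ *ₚ g
  *ₚ-congˡ {[]}    {f′}     g e = ≈-sym (≈[]⇒*ₚ≈[] g (≈-sym e))
  *ₚ-congˡ {a ∷ f} {[]}     g e = ≈[]⇒*ₚ≈[] g e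
  *ₚ-congˡ {a ∷ f} {b ∷ f′} g e =
    +ₚ-cong (·ₚ-congˡ g (proj₁ (∷-injective e))) (∷-cong ≡ₘ-refl (*ₚ-congˡ g (proj₂ (∷-injective e))))

  isCommutativeRing : IsCommutativeRing _≈_ _+ₚ_ _*ₚ_ negₚ [] (const (+ 1))
  isCommutativeRing = record
    { isRing = record
      { +-isAbelianGroup = record
        { isGroup = record
          { isMonoid = record
            { isSemigroup = record
              { isMagma = record { isEquivalence = Setoid.isEquivalence setoid ; ∙-cong = +ₚ-cong }
              ; assoc   = λ f g h → ≡⇒≈ (+ₚ-assoc f g h)
              }
            ; identity = (λ _ → ≈-refl) , (λ f → ≡⇒≈ (+ₚ-identityʳ f))
            }
          ; inverse = comm∧invʳ⇒inv setoid +ₚ-comm≈ -ₚ-inverseʳ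
          ; ⁻¹-cong = ·ₚ-congʳ (ℤ.- + 1)
          }
        ; comm = +ₚ-comm≈
        }
      ; *-cong     = λ {f} {f′} {g} {g′} f≈f′ g≈g′ → ≈-trans (*ₚ-congˡ g f≈f′) (*ₚ-congʳ f′ g≈g′)
      ; *-assoc    = *ₚ-assoc
      ; *-identity = comm∧idˡ⇒id setoid *ₚ-comm *ₚ-identityˡ
      ; distrib    = comm∧distrʳ⇒distr setoid +ₚ-cong *ₚ-comm (λ h f g → *ₚ-distribʳ h f g)
      }
    ; *-comm = *ₚ-comm
    }
    where
    +ₚ-comm≈ : ∀ f g → f +ₚ g ≈ g +ₚ f
    +ₚ-comm≈ f g = ≡⇒≈ (+ₚ-comm f g)
    *ₚ-congʳ : ∀ f {g g′} → g ≈ g′ → f *ₚ g ≈ f *ₚ g′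
    *ₚ-congʳ f {g} {g′} e = ≈-trans (*ₚ-comm f g) (≈-trans (*ₚ-congˡ f e) (*ₚ-comm g′ f))

  ring : CommutativeRing 0ℓ 0ℓ
  ring = record { isCommutativeRing = isCommutativeRing }

  -- The ring solver only cancels coefficients that this test recognises as zero.
  []≈? : ∀ f → Maybe ([] ≈ f)
  []≈? []      = just ≈-refl
  []≈? (a ∷ f) with a ℤ.≟ + 0 | []≈? f
  ... | yes a≡0 | just []≈f = just (≈-sym (≈[]⇒∷≈[] (≡⇒≡ₘ a≡0) (≈-sym []≈f)))
  ... | _       | _         = nothing

  almostCommutativeRing : AlmostCommutativeRing 0ℓ 0ℓ
  almostCommutativeRing = fromCommutativeRing ring []≈?

  x*ₚf≈0∷f : ∀ f → xpow 1 *ₚ f ≈ + 0 ∷ f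
  x*ₚf≈0∷f f = +ₚ-cong (·ₚ-zeroˡ f) (∷-cong ≡ₘ-refl (*ₚ-identityˡ f))

  ∷≈const+x* : ∀ a f → a ∷ f ≈ const a +ₚ xpow 1 *ₚ f
  ∷≈const+x* a f =
    ≈-sym (≈-trans (+ₚ-cong (≈-refl {const a}) (x*ₚf≈0∷f f)) (∷-cong (≡⇒≡ₘ (ℤ.+-identityʳ a)) ≈-refl))

  deriv-cong : ∀ {f g} → f ≈ g → deriv f ≈ deriv g
  deriv-cong {f} {g} e = coeffwise λ n →
    subst₂ _≡ₘ_ (sym (coeff-deriv f n)) (sym (coeff-deriv g n)) (*-congˡₘ (+ suc n) (coeff-≡ₘ e (suc n)))

  deriv-∷ : ∀ a f → deriv (a ∷ f) ≈ f +ₚ xpow 1 *ₚ deriv f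
  deriv-∷ a f = ≈-trans
    (coeffwise-≡ λ n → trans (coeff-deriv (a ∷ f) n) (trans (coeff-≡ n) (sym (coeff-+ₚ f (+ 0 ∷ deriv f) n))))
    (+ₚ-cong (≈-refl {f}) (≈-sym (x*ₚf≈0∷f (deriv f))))
    where
    coeff-≡ : ∀ n → + suc n ℤ.* coeff f n ≡ coeff f n ℤ.+ coeff (+ 0 ∷ deriv f) n
    coeff-≡ zero    = trans (ℤ.*-identityˡ _) (sym (ℤ.+-identityʳ _))
    coeff-≡ (suc n) = trans (ℤ.*-distribʳ-+ (coeff f (suc n)) (+ 1) (+ suc n))
                            (cong₂ ℤ._+_ (ℤ.*-identityˡ (coeff f (suc n))) (sym (coeff-deriv f n)))

  deriv-*ₚ : ∀ f g → deriv (f *ₚ g) ≈ deriv f *ₚ g +ₚ f *ₚ deriv g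
  deriv-*ₚ []      g = ≈-refl
  deriv-*ₚ (a ∷ f) g = begin
    deriv (a ·ₚ g +ₚ (+ 0 ∷ f *ₚ g))
      ≡⟨ trans (deriv-+ₚ (a ·ₚ g) _) (cong (_+ₚ _) (deriv-·ₚ a g)) ⟩
    a ·ₚ deriv g +ₚ deriv (+ 0 ∷ f *ₚ g)
      ≈⟨ +ₚ-cong (≈-sym (const*ₚ a (deriv g)))
                 (≈-trans (deriv-∷ (+ 0) (f *ₚ g)) (+ₚ-cong (≈-refl {f *ₚ g}) (*-congˡ {x} (deriv-*ₚ f g)))) ⟩
    A *ₚ g′ +ₚ (f *ₚ g +ₚ x *ₚ (f′ *ₚ g +ₚ f *ₚ g′))
      ≈⟨ Leibniz-step A x f f′ g g′ ⟩
    (f +ₚ x *ₚ f′) *ₚ g +ₚ (A +ₚ x *ₚ f) *ₚ g′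
      ≈⟨ +ₚ-cong (*-congʳ (≈-sym (deriv-∷ a f))) (*-congʳ (≈-sym (∷≈const+x* a f))) ⟩
    deriv (a ∷ f) *ₚ g +ₚ (a ∷ f) *ₚ g′ ∎
    where
    open CommutativeRing ring using (*-congˡ; *-congʳ)
    A = const a
    x = xpow 1
    f′ = deriv f
    g′ = deriv g
    Leibniz-step : ∀ A x f f′ g g′ →
      A *ₚ g′ +ₚ (f *ₚ g +ₚ x *ₚ (f′ *ₚ g +ₚ f *ₚ g′)) ≈ (f +ₚ x *ₚ f′) *ₚ g +ₚ (A +ₚ x *ₚ f) *ₚ g′
    Leibniz-step = Ring-Solver.solve-∀ almostCommutativeRing

  open Divisibility ring public

  p∣dxs∧x∣p-q⇒p∣dqs : ∀ {P Q D X S} → P ∣ D *ₚ X *ₚ S → X ∣ P -ₚ Q → P ∣ D *ₚ Q *ₚ S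
  p∣dxs∧x∣p-q⇒p∣dqs {P} {Q} {D} {X} {S} p∣dxs x∣p-q =
    ∣ʳ-respʳ-≈ (≈-sym (rearrange P Q D S))
      (∣-- (x∣ʳyx P (D *ₚ S)) (∣ʳ-trans p∣dxs (x∣ʳy⇒xz∣ʳyz S (x∣y⇒zx∣zy D x∣p-q))))
    where
    rearrange : ∀ P Q D S → D *ₚ Q *ₚ S ≈ D *ₚ S *ₚ P -ₚ D *ₚ (P -ₚ Q) *ₚ S
    rearrange = Ring-Solver.solve-∀ almostCommutativeRing

  ≈[p]⇒≈ : ∀ {f g} → f ≈[ p ] g → f ≈ g
  ≈[p]⇒≈ f≈g = coeffwise λ n → mod (ℤ.∣ᵤ⇒∣ (f≈g n))

  ≈⇒≈[p] : ∀ {f g} → f ≈ g → f ≈[ p ] g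
  ≈⇒≈[p] f≈g n = ℤ.∣⇒∣ᵤ (divides-diff (coeff-≡ₘ f≈g n))

  ∣⇒∣[p] : ∀ {f g} → f ∣ g → f ∣[ p ] g
  ∣⇒∣[p] {f} (q , qf≈g) = q , ≈⇒≈[p] (≈-trans (≈-sym qf≈g) (*ₚ-comm q f))

  ∣[p]⇒∣ : ∀ {f g} → f ∣[ p ] g → f ∣ g
  ∣[p]⇒∣ {f} (q , g≈fq) = q , ≈-trans (*ₚ-comm q f) (≈-sym (≈[p]⇒≈ g≈fq))

  const-cong : ∀ {a b} → a ≡ₘ b → const a ≈ const b
  const-cong a≡b = ∷-cong a≡b ≈-refl

  const-* : ∀ a b → const (a ℤ.* b) ≈ const a *ₚ const b
  const-* a b = ≈-sym (const*ₚ a (const b))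

  x-c∣xᵏ-cᵏ : ∀ c k → xpow 1 -ₚ const c ∣ xpow k -ₚ const (c ℤ.^ k)
  x-c∣xᵏ-cᵏ c zero    = [] , ≈-sym (-ₚ-inverseʳ (const (+ 1)))
  x-c∣xᵏ-cᵏ c (suc k) = ∣ʳ-respʳ-≈ (≈-sym (begin
    xpow (suc k) -ₚ const (c ℤ.* c ℤ.^ k)
      ≈⟨ +ₚ-cong (≈-sym (x*ₚf≈0∷f (xpow k))) (·ₚ-congʳ (ℤ.- + 1) (const-* c (c ℤ.^ k))) ⟩
    xpow 1 *ₚ xpow k -ₚ const c *ₚ const (c ℤ.^ k)
      ≈⟨ telescope (xpow 1) (xpow k) (const c) (const (c ℤ.^ k)) ⟩
    xpow 1 *ₚ (xpow k -ₚ const (c ℤ.^ k)) +ₚ const (c ℤ.^ k) *ₚ (xpow 1 -ₚ const c) ∎))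
    (∣-+ (x∣ʳy⇒x∣ʳzy (xpow 1) (x-c∣xᵏ-cᵏ c k)) (x∣ʳyx _ (const (c ℤ.^ k))))
    where
    telescope : ∀ x xᵏ c cᵏ → x *ₚ xᵏ -ₚ c *ₚ cᵏ ≈ x *ₚ (xᵏ -ₚ cᵏ) +ₚ cᵏ *ₚ (x -ₚ c)
    telescope = Ring-Solver.solve-∀ almostCommutativeRing

  ∏∣deriv[∏*s]*f : ∀ {fs f} → All (_∣ f) fs → ∀ s → productₚ fs ∣ deriv (productₚ fs *ₚ s) *ₚ f
  ∏∣deriv[∏*s]*f []                       s = ε∣ _
  ∏∣deriv[∏*s]*f {g ∷ fs} {f} (g∣f ∷ fs∣f) s = ∣ʳ-respʳ-≈ (≈-sym (begin
    deriv ((g *ₚ Π) *ₚ s) *ₚ f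
      ≈⟨ *ₚ-congˡ f (≈-trans (deriv-cong (*ₚ-assoc g Π s)) (deriv-*ₚ g (Π *ₚ s))) ⟩
    (deriv g *ₚ (Π *ₚ s) +ₚ g *ₚ deriv (Π *ₚ s)) *ₚ f
      ≈⟨ regroup (deriv g) g Π s f (deriv (Π *ₚ s)) ⟩
    (deriv g *ₚ s) *ₚ (f *ₚ Π) +ₚ g *ₚ (deriv (Π *ₚ s) *ₚ f) ∎))
    (∣-+ (x∣ʳy⇒x∣ʳzy (deriv g *ₚ s) (x∣ʳy⇒xz∣ʳyz Π g∣f)) (x∣y⇒zx∣zy g (∏∣deriv[∏*s]*f fs∣f s)))
    where
    Π = productₚ fs
    regroup : ∀ g′ g Π s f Π′ →
      (g′ *ₚ (Π *ₚ s) +ₚ g *ₚ Π′) *ₚ f ≈ (g′ *ₚ s) *ₚ (f *ₚ Π) +ₚ g *ₚ (Π′ *ₚ f)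
    regroup = Ring-Solver.solve-∀ almostCommutativeRing

  p≈cπs∧π∣[πs]′x⇒p∣p′xs : ∀ {P c Π S X} → P ≈ const c *ₚ (Π *ₚ S) → Π ∣ deriv (Π *ₚ S) *ₚ X →
                           P ∣ deriv P *ₚ X *ₚ S
  p≈cπs∧π∣[πs]′x⇒p∣p′xs {P} {c} {Π} {S} {X} P≈cΠS Π∣[ΠS]′X =
    ∣ʳ-respʳ-≈ (≈-sym D≈) (∣ʳ-respˡ-≈ (≈-sym (≈-trans P≈cΠS (≈-sym (*ₚ-assoc (const c) Π S))))
      (x∣ʳy⇒xz∣ʳyz S (x∣y⇒zx∣zy (const c) Π∣[ΠS]′X)))
    where
    D≈ : deriv P *ₚ X *ₚ S ≈ const c *ₚ (deriv (Π *ₚ S) *ₚ X) *ₚ S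
    D≈ = ≈-trans (*ₚ-congˡ S (*ₚ-congˡ X (≈-trans (deriv-cong P≈cΠS) (deriv-*ₚ (const c) (Π *ₚ S)))))
                 (*ₚ-congˡ S (*ₚ-assoc (const c) (deriv (Π *ₚ S)) X))

-- Fermat's little theorem and linear factors of xᵖ − x

module Fermat (q : ℕ) (p-prime : Prime (suc (suc q))) where

  p : ℕ
  p = suc (suc q)

  open Modulo p
  open import Relation.Binary.Reasoning.Setoid ≡ₘ-setoid

  freshmans-dream : ∀ x y → (x ℤ.+ y) ℤ.^ p ≡ₘ x ℤ.^ p ℤ.+ y ℤ.^ p
  freshmans-dream x y = begin
    (x ℤ.+ y) ℤ.^ p                                 ≡⟨ ^≡^ (x ℤ.+ y) p ⟨
    (x ℤ.+ y) ℤ-Exp.^ p                              ≡⟨ binomial-theorem p x y ⟩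
    t Fin.zero ℤ.+ sum (tail t)                      ≡⟨ cong (ℤ._+_ (t Fin.zero)) (sum-init-last (tail t)) ⟩
    t Fin.zero ℤ.+ (sum (init (tail t)) ℤ.+ last (tail t))
      ≈⟨ +-congₘ (≡⇒≡ₘ first) (+-congₘ (∣⇒≡ₘ0 (∣-sum _ middle)) (≡⇒≡ₘ final)) ⟩
    y ℤ.^ p ℤ.+ (+ 0 ℤ.+ x ℤ.^ p)                    ≡⟨ cong (ℤ._+_ (y ℤ.^ p)) (ℤ.+-identityˡ _) ⟩
    y ℤ.^ p ℤ.+ x ℤ.^ p                              ≡⟨ ℤ.+-comm (y ℤ.^ p) (x ℤ.^ p) ⟩
    x ℤ.^ p ℤ.+ y ℤ.^ p                              ∎
    where
    t = binomialTerm x y p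
    first : t Fin.zero ≡ y ℤ.^ p
    first = trans (ℤ.+-identityʳ _) (trans (ℤ.*-identityˡ _) (^≡^ y p))
    middle : ∀ i → + p ℤ.∣ init (tail t) i
    middle i = subst (+ p ℤ.∣_) (sym (×≡* (p C k) _))
      (ℤ.∣m⇒∣m*n {m = + (p C k)} _ (ℤ.∣ᵤ⇒∣ (prime∣pCk p-prime (ℕ.s≤s ℕ.z≤n) (ℕ.s<s k<p′))))
      where
      k = suc (toℕ (inject₁ i))
      k<p′ : toℕ (inject₁ i) < suc q
      k<p′ = subst (_< suc q) (sym (Fin.toℕ-inject₁ i)) (Fin.toℕ<n i)
    final : last (tail t) ≡ x ℤ.^ p
    final = trans (cong term (Fin.toℕ-fromℕ (suc q)))
      (trans (cong₂ (λ c e → c ℤ-Mult.× (x ℤ-Exp.^ p ℤ.* y ℤ-Exp.^ e)) (nCn≡1 p) (ℕ.n∸n≡0 q))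
      (trans (ℤ.+-identityʳ _) (trans (ℤ.*-identityʳ _) (^≡^ x p))))
      where
      term : ℕ → ℤ
      term k = (p C suc k) ℤ-Mult.× (x ℤ-Exp.^ suc k ℤ.* y ℤ-Exp.^ (p ℕ.∸ suc k))

  rᵖ≡r⇒[1+r]ᵖ≡1+r : ∀ r → r ℤ.^ p ≡ₘ r → (+ 1 ℤ.+ r) ℤ.^ p ≡ₘ + 1 ℤ.+ r
  rᵖ≡r⇒[1+r]ᵖ≡1+r r rᵖ≡r = begin
    (+ 1 ℤ.+ r) ℤ.^ p      ≈⟨ freshmans-dream (+ 1) r ⟩
    (+ 1) ℤ.^ p ℤ.+ r ℤ.^ p  ≈⟨ +-congₘ (≡⇒≡ₘ (ℤ.^-zeroˡ p)) rᵖ≡r ⟩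
    + 1 ℤ.+ r              ∎

  [1+r]ᵖ≡1+r⇒rᵖ≡r : ∀ r → (+ 1 ℤ.+ r) ℤ.^ p ≡ₘ + 1 ℤ.+ r → r ℤ.^ p ≡ₘ r
  [1+r]ᵖ≡1+r⇒rᵖ≡r r [1+r]ᵖ≡1+r = begin
    r ℤ.^ p                                ≡⟨ 1+a-1≡a (r ℤ.^ p) ⟨
    (+ 1 ℤ.+ r ℤ.^ p) ℤ.- + 1              ≡⟨ cong (λ c → (c ℤ.+ r ℤ.^ p) ℤ.- + 1) (ℤ.^-zeroˡ p) ⟨
    ((+ 1) ℤ.^ p ℤ.+ r ℤ.^ p) ℤ.- + 1        ≈⟨ +-congₘ (≡ₘ-sym (freshmans-dream (+ 1) r)) ≡ₘ-refl ⟩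
    (+ 1 ℤ.+ r) ℤ.^ p ℤ.- + 1              ≈⟨ +-congₘ [1+r]ᵖ≡1+r ≡ₘ-refl ⟩
    (+ 1 ℤ.+ r) ℤ.- + 1                    ≡⟨ 1+a-1≡a r ⟩
    r                                      ∎
    where 1+a-1≡a : ∀ a → (+ 1 ℤ.+ a) ℤ.- + 1 ≡ a
          1+a-1≡a = solve-∀

  fermats-little-theorem : ∀ r → r ℤ.^ p ≡ₘ r
  fermats-little-theorem (+ zero)       = ≡ₘ-refl
  fermats-little-theorem (+ suc n)      = rᵖ≡r⇒[1+r]ᵖ≡1+r (+ n) (fermats-little-theorem (+ n))
  fermats-little-theorem -[1+ zero ]    = [1+r]ᵖ≡1+r⇒rᵖ≡r -[1+ zero ] (fermats-little-theorem (+ zero))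
  fermats-little-theorem -[1+ suc n ]   = [1+r]ᵖ≡1+r⇒rᵖ≡r -[1+ suc n ] (fermats-little-theorem -[1+ n ])

  p∤a⇒a*aᵠ≡1 : ∀ {a} → ¬ + p ℤ.∣ a → a ℤ.* a ℤ.^ q ≡ₘ + 1
  p∤a⇒a*aᵠ≡1 {a} p∤a = [ ⊥-elim ∘ p∤a , mod ]′
    (euclidsLemma-ℤ a (a ℤ.* a ℤ.^ q ℤ.- + 1) p-prime
      (subst (+ p ℤ.∣_) (factor a (a ℤ.^ q)) (divides-diff (fermats-little-theorem a))))
    where factor : ∀ a t → a ℤ.* (a ℤ.* t) ℤ.- a ≡ a ℤ.* (a ℤ.* t ℤ.- + 1)
          factor = solve-∀

module LinearFactors (q : ℕ) (p-prime : Prime (suc (suc q))) where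

  open Fermat q p-prime using (p; fermats-little-theorem; p∤a⇒a*aᵠ≡1)
  open Modulo p
  open import Relation.Binary.Reasoning.Setoid setoid

  xᵖ-x : Poly
  xᵖ-x = xpow p -ₚ xpow 1

  x-c∣xᵖ-x : ∀ c → xpow 1 -ₚ const c ∣ xᵖ-x
  x-c∣xᵖ-x c = ∣ʳ-respʳ-≈ (≈-sym (begin
    xpow p -ₚ xpow 1                                 ≈⟨ cancel (xpow p) (xpow 1) (const c) ⟩
    (xpow p -ₚ const c) -ₚ (xpow 1 -ₚ const c)
      ≈⟨ +ₚ-cong (+ₚ-cong (≈-refl {xpow p}) (·ₚ-congʳ (ℤ.- + 1) cᵖ≈c)) (≈-refl {negₚ (xpow 1 -ₚ const c)}) ⟨
    (xpow p -ₚ const (c ℤ.^ p)) -ₚ (xpow 1 -ₚ const c) ∎))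
    (∣-- (x-c∣xᵏ-cᵏ c p) ∣ʳ-refl)
    where
    cᵖ≈c : const (c ℤ.^ p) ≈ const c
    cᵖ≈c = const-cong (fermats-little-theorem c)
    acr : AlmostCommutativeRing 0ℓ 0ℓ
    acr = almostCommutativeRing
    cancel : ∀ xᵖ x c → xᵖ -ₚ x ≈ (xᵖ -ₚ c) -ₚ (x -ₚ c)
    cancel = Ring-Solver.solve-∀ acr

  linear∣xᵖ-x : ∀ {b a} → NonZeroMod p a → linear (b , a) ∣ xᵖ-x
  linear∣xᵖ-x {b} {a} a≢0 = ∣ʳ-trans (const u , uL≈x-c) (x-c∣xᵖ-x (ℤ.- (b ℤ.* u)))
    where
    -- u = aᵖ⁻² inverts a, so u·(b + a x) = x − c with c = −b·u.
    u = a ℤ.^ q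
    uL≈x-c : const u *ₚ linear (b , a) ≈ xpow 1 -ₚ const (ℤ.- (b ℤ.* u))
    uL≈x-c = coeffwise λ
      { zero          → ≡⇒≡ₘ (constant-coeff b u)
      ; (suc zero)    → ≡ₘ-trans (≡⇒≡ₘ (ℤ.*-comm u a)) (p∤a⇒a*aᵠ≡1 {a} (a≢0 ∘ ℤ.∣⇒∣ᵤ))
      ; (suc (suc n)) → ≡ₘ-refl
      }
      where constant-coeff : ∀ b u → u ℤ.* b ℤ.+ + 0 ≡ + 0 ℤ.+ (ℤ.- + 1) ℤ.* (ℤ.- (b ℤ.* u))
            constant-coeff = solve-∀

  linears∣xᵖ-x : ∀ {ls} → AllDegOne p ls → All (_∣ xᵖ-x) (linears ls)
  linears∣xᵖ-x []           = []
  linears∣xᵖ-x (a≢0 ∷ ls)   = linear∣xᵖ-x a≢0 ∷ linears∣xᵖ-x ls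

lemma4p2 : (p : ℕ) → Prime p → (P R S : Poly) →
    P ≈[ p ] (R *ₚ S) → CompletelyReducible p R →
    (Pbar : Poly) → length Pbar ≤ p → (xpow p -ₚ xpow 1) ∣[ p ] (P -ₚ Pbar) →
    P ∣[ p ] (deriv P *ₚ Pbar *ₚ S)
lemma4p2 zero       ()
lemma4p2 (suc zero) ()
lemma4p2 p@(suc (suc q)) p-prime P R S P≈RS (c , ls , _ , degOne , R≈cΠ) Pbar _ xᵖ-x∣P-Pbar =
  ∣⇒∣[p] (p∣dxs∧x∣p-q⇒p∣dqs {D = deriv P} {S = S} P∣P′·xᵖ-x·S (∣[p]⇒∣ xᵖ-x∣P-Pbar))
  where
  open Modulo p
  open LinearFactors q p-prime using (xᵖ-x; linears∣xᵖ-x)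
  Π = productₚ (linears ls)
  P≈cΠS : P ≈ const c *ₚ (Π *ₚ S)
  P≈cΠS = ≈-trans (≈[p]⇒≈ P≈RS)
                  (≈-trans (*ₚ-congˡ S (≈[p]⇒≈ {R} {const c *ₚ Π} R≈cΠ)) (*ₚ-assoc (const c) Π S))
  P∣P′·xᵖ-x·S : P ∣ deriv P *ₚ xᵖ-x *ₚ S
  P∣P′·xᵖ-x·S = p≈cπs∧π∣[πs]′x⇒p∣p′xs P≈cΠS (∏∣deriv[∏*s]*f (linears∣xᵖ-x degOne) S)
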